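{- Let $k\geq 2$ and $n$ be positive integers and let $p$ be a prime with $k\leq p$. Let $G$ be a finite simple graph with $n^2$ vertices and $O\chi_k(G)=n$, and let $H$ be any finite simple graph with $p^2$ vertices. Then $O\chi_k(G\times H)=np$.
   Context: Two vertex colourings $c,c'$ of a graph are orthogonal if no two distinct vertices $u\neq v$ satisfy both $c(u)=c(v)$ and $c'(u)=c'(v)$. A $k$-orthogonal colouring of a graph is a collection of $k$ proper vertex colourings that are pairwise orthogonal. The $k$-orthogonal chromatic number $O\chi_k(G)$ is the minimum $N$ such that $G$ has a $k$-orthogonal colouring in which every colouring uses colours from a set of $N$ colours. The tensor product $G\times H$ has vertex set $V(G)\times V(H)$, with $(u_1,v_1)$ adjacent to $(u_2,v_2)$ iff $u_1u_2\in E(G)$ and $v_1v_2\in E(H)$. -}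

module Defs where

open import Level using (0ℓ)
open import Data.Nat using (ℕ; _≤_)
open import Data.Fin using (Fin; combine; remQuot)
open import Data.Product using (Σ; _×_; _,_; proj₁; proj₂)
open import Relation.Binary.PropositionalEquality using (_≡_)
open import Relation.Nullary using (¬_)

record Graph (n : ℕ) : Set₁ where
  field
    Adj   : Fin n → Fin n → Set
    sym   : ∀ {u v} → Adj u v → Adj v u
    irrefl : ∀ {u} → ¬ Adj u u
open Graph public

Colouring : ℕ → ℕ → Set
Colouring n N = Fin n → Fin N

Proper : ∀ {n N} → Graph n → Colouring n N → Set
Proper G c = ∀ u v → Adj G u v → ¬ (c u ≡ c v)

Orthogonal : ∀ {n N} → Colouring n N → Colouring n N → Set
Orthogonal {n} c c' = ∀ (u v : Fin n) → ¬ (u ≡ v) → c u ≡ c v → ¬ (c' u ≡ c' v)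

HasOrthColouring : ∀ {n} → ℕ → Graph n → ℕ → Set
HasOrthColouring {n} k G N =
  Σ (Fin k → Colouring n N) λ cs →
    (∀ i → Proper G (cs i)) ×
    (∀ i j → ¬ (i ≡ j) → Orthogonal (cs i) (cs j))

OrthChromaticNumberIs : ∀ {n} → ℕ → Graph n → ℕ → Set
OrthChromaticNumberIs k G N =
  HasOrthColouring k G N × (∀ M → HasOrthColouring k G M → N ≤ M)

-- Tensor product G × H on Fin (a * b); the vertex (u , v) of
-- Fin a × Fin b is encoded as combine u v, decoded by remQuot.
fstV : ∀ {a b} → Fin (a Data.Nat.* b) → Fin a
fstV {a} {b} x = proj₁ (remQuot {a} b x)

sndV : ∀ {a b} → Fin (a Data.Nat.* b) → Fin b
sndV {a} {b} x = proj₂ (remQuot {a} b x)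

tensor : ∀ {a b} → Graph a → Graph b → Graph (a Data.Nat.* b)
tensor {a} {b} G H = record
  { Adj = λ x y → Adj G (fstV {a} {b} x) (fstV {a} {b} y) ×
                  Adj H (sndV {a} {b} x) (sndV {a} {b} y)
  ; sym = λ (p , q) → sym G p , sym H q
  ; irrefl = λ (p , q) → irrefl G p
  }

-- Two orthogonal colourings of a graph with N colours separate its vertices, so a
-- graph on (np)² vertices needs at least np colours. Conversely, index the vertices
-- of H by 𝔽ₚ² and colour them by the parallel classes of lines of slopes
-- 0, …, k − 1: lines of different slopes meet in at most one point, so these
-- colourings are pairwise orthogonal. Pairing them with a k-orthogonal
-- colouring of G with n colours gives one of G × H with np colours, proper because
-- adjacency in G × H implies adjacency in G.
module Submission where

open import Data.Nat as ℕ
  using (ℕ; zero; suc; _≤_; _<_; _^_; NonZero; _%_; _/_; s≤s)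
import Data.Nat.Properties as ℕₚ
open import Data.Nat.DivMod using (m≡m%n+[m/n]*n; _mod_)
open import Data.Nat.Divisibility as ℕ∣ using (∣⇒≤)
open import Data.Nat.Primality using (Prime; prime⇒nonZero; euclidsLemma)
open import Data.Nat.Tactic.RingSolver as ℕSolver using ()
open import Data.Integer as ℤ using (+_; _-_; ∣_∣)
import Data.Integer.Properties as ℤₚ
open import Data.Integer.Divisibility.Signed using (_∣_; divides; ∣⇒∣ᵤ; ∣ᵤ⇒∣; ∣m∣n⇒∣m-n; ∣n⇒∣m*n)
open import Data.Integer.Tactic.RingSolver using (solve-∀)
open import Data.Fin as Fin using (Fin; toℕ; combine; finToFun; funToFin)
import Data.Fin.Properties as Finₚ
open import Data.Product using (_×_; _,_; proj₁; proj₂)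
open import Data.Product.Properties using (,-injectiveˡ; ,-injectiveʳ)
open import Data.Sum using (_⊎_; fromInj₂)
import Data.Sum as Sum
open import Data.Empty using (⊥-elim)
open import Function using (_∘_)
open import Relation.Binary.PropositionalEquality
  using (_≡_; _≢_; refl; sym; trans; cong; cong₂; subst; module ≡-Reasoning)
open import Relation.Nullary using (¬_; contradiction; yes; no)

open import Defs hiding (sym)

module _ where
  open ℤ using (_+_; _*_)

  pos-affine : ∀ a s b → + (a ℕ.+ s ℕ.* b) ≡ + a + + s * + b
  pos-affine a s b = trans (ℤₚ.pos-+ a (s ℕ.* b)) (cong (λ z → + a + z) (ℤₚ.pos-* s b))

  %≡%⇒∣- : ∀ {x y p} .{{_ : NonZero p}} → x % p ≡ y % p → + p ∣ + x - + y
  %≡%⇒∣- {x} {y} {p} x%p≡y%p = divides (+ (x / p) - + (y / p)) (begin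
    + x - + y
      ≡⟨ cong₂ _-_ (remainder+quotient x) (remainder+quotient y) ⟩
    (+ (x % p) + + (x / p) * + p) - (+ (y % p) + + (y / p) * + p)
      ≡⟨ cong (λ r → (+ r + + (x / p) * + p) - (+ (y % p) + + (y / p) * + p)) x%p≡y%p ⟩
    (+ (y % p) + + (x / p) * + p) - (+ (y % p) + + (y / p) * + p)
      ≡⟨ cancel-remainder (+ (y % p)) (+ (x / p)) (+ (y / p)) (+ p) ⟩
    (+ (x / p) - + (y / p)) * + p ∎)
    where
    open ≡-Reasoning
    remainder+quotient : ∀ m → + m ≡ + (m % p) + + (m / p) * + p
    remainder+quotient m = trans (cong +_ (m≡m%n+[m/n]*n m p)) (pos-affine (m % p) (m / p) p)
    cancel-remainder : ∀ r q q′ P → (r + q * P) - (r + q′ * P) ≡ (q - q′) * P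
    cancel-remainder = solve-∀

  ∣∧<⇒≡0 : ∀ {m n} → m ℕ∣.∣ n → n < m → n ≡ 0
  ∣∧<⇒≡0 {n = zero}  _   _   = refl
  ∣∧<⇒≡0 {n = suc _} m∣n n<m = contradiction (∣⇒≤ m∣n) (ℕₚ.<⇒≱ n<m)

  ∣-∧<⇒≡ : ∀ {p u v} → u < p → v < p → + p ∣ + u - + v → u ≡ v
  ∣-∧<⇒≡ {p} {u} {v} u<p v<p p∣u-v =
    ℤₚ.+-injective (ℤₚ.i-j≡0⇒i≡j _ _ (ℤₚ.∣i∣≡0⇒i≡0 (∣∧<⇒≡0 (∣⇒∣ᵤ p∣u-v) ∣u-v∣<p)))
    where
    ∣u-v∣<p : ∣ + u - + v ∣ < p
    ∣u-v∣<p = subst (_< p) (cong ∣_∣ (sym (ℤₚ.m-n≡m⊖n u v)))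
      (ℕₚ.≤-<-trans (ℤₚ.∣m⊝n∣≤m⊔n u v) (ℕₚ.⊔-pres-<m u<p v<p))

  euclidsLemmaℤ : ∀ {p} i j → Prime p → + p ∣ i * j → (+ p ∣ i) ⊎ (+ p ∣ j)
  euclidsLemmaℤ {p} i j p-prime p∣ij = Sum.map ∣ᵤ⇒∣ ∣ᵤ⇒∣
    (euclidsLemma ∣ i ∣ ∣ j ∣ p-prime (subst (p ℕ∣.∣_) (ℤₚ.abs-* i j) (∣⇒∣ᵤ p∣ij)))

  -- Lines of different slopes in 𝔽ₚ² meet in at most one point.
  ∣-affine-cancel : ∀ {p} a a′ b b′ s t → Prime p → ¬ (+ p ∣ s - t) →
    + p ∣ (a + s * b) - (a′ + s * b′) → + p ∣ (a + t * b) - (a′ + t * b′) →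
    (+ p ∣ a - a′) × (+ p ∣ b - b′)
  ∣-affine-cancel {p} a a′ b b′ s t p-prime p∤s-t p∣s-line p∣t-line = p∣a-a′ , p∣b-b′
    where
    slope-difference : ∀ a a′ b b′ s t →
      ((a + s * b) - (a′ + s * b′)) - ((a + t * b) - (a′ + t * b′)) ≡ (s - t) * (b - b′)
    slope-difference = solve-∀
    intercept-difference : ∀ a a′ b b′ s →
      ((a + s * b) - (a′ + s * b′)) - s * (b - b′) ≡ a - a′
    intercept-difference = solve-∀
    p∣b-b′ : + p ∣ b - b′
    p∣b-b′ = fromInj₂ (⊥-elim ∘ p∤s-t)
      (euclidsLemmaℤ (s - t) (b - b′) p-prime
        (subst (+ p ∣_) (slope-difference a a′ b b′ s t) (∣m∣n⇒∣m-n p∣s-line p∣t-line)))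
    p∣a-a′ : + p ∣ a - a′
    p∣a-a′ = subst (+ p ∣_) (intercept-difference a a′ b b′ s)
      (∣m∣n⇒∣m-n p∣s-line (∣n⇒∣m*n s p∣b-b′))

module _ {n N : ℕ} where

  JointlyInjective : Colouring n N → Colouring n N → Set
  JointlyInjective c c′ = ∀ {u v} → c u ≡ c v → c′ u ≡ c′ v → u ≡ v

  orthogonal⇒jointlyInjective : ∀ {c c′} → Orthogonal c c′ → JointlyInjective c c′
  orthogonal⇒jointlyInjective orth {u} {v} cu≡cv c′u≡c′v with u Fin.≟ v
  ... | yes u≡v = u≡v
  ... | no  u≢v = contradiction c′u≡c′v (orth u v u≢v cu≡cv)

  jointlyInjective⇒orthogonal : ∀ {c c′} → JointlyInjective c c′ → Orthogonal c c′
  jointlyInjective⇒orthogonal inj u v u≢v cu≡cv c′u≡c′v = u≢v (inj cu≡cv c′u≡c′v)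

  orthogonal⇒≤² : ∀ {c c′} → Orthogonal c c′ → n ≤ N ℕ.* N
  orthogonal⇒≤² {c} {c′} orth = Finₚ.injective⇒≤ {f = λ u → combine (c u) (c′ u)}
    λ {u} {v} eq → let cu≡cv , c′u≡c′v = Finₚ.combine-injective _ _ _ _ eq
                   in orthogonal⇒jointlyInjective orth cu≡cv c′u≡c′v

PairwiseOrthogonal : ∀ {k n N} → (Fin k → Colouring n N) → Set
PairwiseOrthogonal cs = ∀ i j → i ≢ j → Orthogonal (cs i) (cs j)

hasOrthColouring⇒≤² : ∀ {k a M} (G : Graph a) → 2 ≤ k → HasOrthColouring k G M → a ≤ M ℕ.* M
hasOrthColouring⇒≤² _ (s≤s (s≤s _)) (_ , _ , orth) =
  orthogonal⇒≤² (orth Fin.zero (Fin.suc Fin.zero) λ ())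

module _ {a b : ℕ} where

  _⊗_ : ∀ {N M} → Colouring a N → Colouring b M → Colouring (a ℕ.* b) (N ℕ.* M)
  (c ⊗ d) x = combine (c (fstV {a} {b} x)) (d (sndV {a} {b} x))

  fstV-sndV-injective : ∀ {x y} → fstV {a} {b} x ≡ fstV {a} {b} y →
    sndV {a} {b} x ≡ sndV {a} {b} y → x ≡ y
  fstV-sndV-injective {x} {y} fx≡fy sx≡sy = begin
    x                                         ≡⟨ Finₚ.combine-remQuot {a} b x ⟨
    combine (fstV {a} {b} x) (sndV {a} {b} x) ≡⟨ cong₂ combine fx≡fy sx≡sy ⟩
    combine (fstV {a} {b} y) (sndV {a} {b} y) ≡⟨ Finₚ.combine-remQuot {a} b y ⟩
    y                                         ∎
    where open ≡-Reasoning

  ⊗-proper : ∀ {N M} (G : Graph a) (H : Graph b) {c : Colouring a N} (d : Colouring b M) →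
    Proper G c → Proper (tensor G H) (c ⊗ d)
  ⊗-proper _ _ {c} d proper u v (adjG , _) eq =
    proper _ _ adjG (Finₚ.combine-injectiveˡ (c _) (d _) (c _) (d _) eq)

  ⊗-orthogonal : ∀ {N M} {c c′ : Colouring a N} {d d′ : Colouring b M} →
    Orthogonal c c′ → Orthogonal d d′ → Orthogonal (c ⊗ d) (c′ ⊗ d′)
  ⊗-orthogonal {c = c} {c′} {d} {d′} orth-c orth-d = jointlyInjective⇒orthogonal λ eq eq′ →
    let cx≡cy , dx≡dy = Finₚ.combine-injective (c _) (d _) (c _) (d _) eq
        c′x≡c′y , d′x≡d′y = Finₚ.combine-injective (c′ _) (d′ _) (c′ _) (d′ _) eq′
    in fstV-sndV-injective (orthogonal⇒jointlyInjective orth-c cx≡cy c′x≡c′y)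
                           (orthogonal⇒jointlyInjective orth-d dx≡dy d′x≡d′y)

tensor-hasOrthColouring : ∀ {k a b N M} (G : Graph a) (H : Graph b) →
  HasOrthColouring k G N → (ds : Fin k → Colouring b M) → PairwiseOrthogonal ds →
  HasOrthColouring k (tensor G H) (N ℕ.* M)
tensor-hasOrthColouring G H (cs , proper , orth) ds orth-ds =
  (λ i → cs i ⊗ ds i) ,
  (λ i → ⊗-proper G H (ds i) (proper i)) ,
  (λ i j i≢j → ⊗-orthogonal (orth i j i≢j) (orth-ds i j i≢j))

module Lines (p : ℕ) .{{_ : NonZero p}} where

  -- The base-p digits of a vertex are its coordinates in 𝔽ₚ².
  coordinates : Fin (p ^ 2) → Fin p × Fin p
  coordinates x = digit x Fin.zero , digit x (Fin.suc Fin.zero)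
    where digit = finToFun {p} {2}

  coordinates-injective : ∀ {x y} → coordinates x ≡ coordinates y → x ≡ y
  coordinates-injective {x} {y} eq = begin
    x                              ≡⟨ Finₚ.funToFin-finToFin {2} {p} x ⟨
    funToFin (finToFun {p} {2} x) ≡⟨ cong₂ (λ a b → combine a (combine b Fin.zero))
                                        (,-injectiveˡ eq) (,-injectiveʳ eq) ⟩
    funToFin (finToFun {p} {2} y) ≡⟨ Finₚ.funToFin-finToFin {2} {p} y ⟩
    y                              ∎
    where open ≡-Reasoning

  line : ℕ → Fin p × Fin p → Fin p
  line s (a , b) = (toℕ a ℕ.+ s ℕ.* toℕ b) mod p

  line-congruence : ∀ s {a b a′ b′} → line s (a , b) ≡ line s (a′ , b′) →
    + p ∣ (+ toℕ a ℤ.+ + s ℤ.* + toℕ b) - (+ toℕ a′ ℤ.+ + s ℤ.* + toℕ b′)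
  line-congruence s {a} {b} {a′} {b′} eq =
    subst (+ p ∣_) (cong₂ _-_ (pos-affine (toℕ a) s (toℕ b)) (pos-affine (toℕ a′) s (toℕ b′)))
      (%≡%⇒∣- (trans (sym (toℕ-mod _)) (trans (cong toℕ eq) (toℕ-mod _))))
    where
    toℕ-mod : ∀ m → toℕ (m mod p) ≡ m % p
    toℕ-mod m = Finₚ.toℕ-fromℕ< _

  lines-jointlyInjective : Prime p → ∀ {s t} → s < p → t < p → s ≢ t →
    ∀ {x y} → line s x ≡ line s y → line t x ≡ line t y → x ≡ y
  lines-jointlyInjective p-prime {s} {t} s<p t<p s≢t {a , b} {a′ , b′} eqₛ eqₜ =
    cong₂ _,_ (Finₚ.toℕ-injective (∣-∧<⇒≡ (Finₚ.toℕ<n a) (Finₚ.toℕ<n a′) p∣a-a′))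
              (Finₚ.toℕ-injective (∣-∧<⇒≡ (Finₚ.toℕ<n b) (Finₚ.toℕ<n b′) p∣b-b′))
    where
    p∤s-t : ¬ (+ p ∣ + s - + t)
    p∤s-t = s≢t ∘ ∣-∧<⇒≡ s<p t<p
    divisibilities = ∣-affine-cancel (+ toℕ a) (+ toℕ a′) (+ toℕ b) (+ toℕ b′) (+ s) (+ t) p-prime p∤s-t
      (line-congruence s eqₛ) (line-congruence t eqₜ)
    p∣a-a′ = proj₁ divisibilities
    p∣b-b′ = proj₂ divisibilities

  lineColouring : ℕ → Colouring (p ^ 2) p
  lineColouring s = line s ∘ coordinates

  lineColourings-pairwiseOrthogonal : ∀ {k} → Prime p → k ≤ p →
    PairwiseOrthogonal (λ (i : Fin k) → lineColouring (toℕ i))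
  lineColourings-pairwiseOrthogonal p-prime k≤p i j i≢j =
    jointlyInjective⇒orthogonal λ eqᵢ eqⱼ → coordinates-injective
      (lines-jointlyInjective p-prime (slope< i) (slope< j) (i≢j ∘ Finₚ.toℕ-injective) eqᵢ eqⱼ)
    where
    slope< : ∀ i → toℕ i < p
    slope< i = ℕₚ.<-≤-trans (Finₚ.toℕ<n i) k≤p

m*m≤n*n⇒m≤n : ∀ {m n} → m ℕ.* m ≤ n ℕ.* n → m ≤ n
m*m≤n*n⇒m≤n {m} {n} m²≤n² with m ℕ.≤? n
... | yes m≤n = m≤n
... | no  m≰n = let n<m = ℕₚ.≰⇒> m≰n in contradiction m²≤n² (ℕₚ.<⇒≱ (ℕₚ.*-mono-< n<m n<m))

square-of-product : ∀ m n → m ^ 2 ℕ.* n ^ 2 ≡ (m ℕ.* n) ℕ.* (m ℕ.* n)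
square-of-product = lemma
  where
  lemma : ∀ m n → m ℕ.* (m ℕ.* 1) ℕ.* (n ℕ.* (n ℕ.* 1)) ≡ (m ℕ.* n) ℕ.* (m ℕ.* n)
  lemma = ℕSolver.solve-∀

mainTheorem7 : (k n p : ℕ) → 2 ≤ k → 1 ≤ n → Prime p → k ≤ p →
    (G : Graph (n ^ 2)) → OrthChromaticNumberIs k G n →
    (H : Graph (p ^ 2)) →
    OrthChromaticNumberIs k (tensor G H) (n ℕ.* p)
mainTheorem7 k n p 2≤k _ p-prime k≤p G (colouringG , _) H = upper , lower
  where
  instance
    p≢0 : NonZero p
    p≢0 = prime⇒nonZero p-prime
  open Lines p
  upper : HasOrthColouring k (tensor G H) (n ℕ.* p)
  upper = tensor-hasOrthColouring G H colouringG (lineColouring ∘ toℕ)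
    (lineColourings-pairwiseOrthogonal p-prime k≤p)
  lower : ∀ M → HasOrthColouring k (tensor G H) M → n ℕ.* p ≤ M
  lower M colouring = m*m≤n*n⇒m≤n
    (subst (_≤ M ℕ.* M) (square-of-product n p) (hasOrthColouring⇒≤² (tensor G H) 2≤k colouring))
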